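{- Let $X$, $M$, $N$ be SF-normal forms and $O \in \{\mathbf{S},\mathbf{F}\}$ such that $O\,X\,M\,N \rightarrow_{\mathrm{SF}} R$. Then for every $\mathrm{SF}^{\mathcal{C}}_{@}$-term context $\mathcal{C}$ there is a reduction sequence $\mathcal{C}[[\![O\,X\,M\,N]\!]_{@}] \rightarrow_{\mathrm{SF}^{\mathcal{C}}_{@}}^{\ast} \mathcal{C}[[\![R]\!]_{@}]$ which is perpetual.
   Context: SF-calculus: terms are given by $M, N ::= \mathbf{S} \mid \mathbf{F} \mid M\,N$ (application, left-associative; no variables). Terms of the form $\mathbf{S}$, $\mathbf{F}$, $\mathbf{S}\,M$, $\mathbf{F}\,M$, $\mathbf{S}\,M\,N$, $\mathbf{F}\,M\,N$ are called factorable forms. The one-step reduction $\rightarrow_{\mathrm{SF}}$ is the smallest relation closed under term contexts satisfying: $\mathbf{S}\,M\,N\,X \rightarrow_{\mathrm{SF}} M\,X\,(N\,X)$; $\mathbf{F}\,O\,M\,N \rightarrow_{\mathrm{SF}} M$ if $O$ is $\mathbf{S}$ or $\mathbf{F}$; $\mathbf{F}\,(P\,Q)\,M\,N \rightarrow_{\mathrm{SF}} N\,P\,Q$ if $P\,Q$ is a factorable form. An SF-normal form is an SF-term admitting no $\rightarrow_{\mathrm{SF}}$ step. Curryfied applicative SF-calculus $\mathrm{SF}^{\mathcal{C}}_{@}$: the first-order term rewriting system over the signature with constructors $\mathbf{S}_0,\mathbf{F}_0$ (arity 0), $\mathbf{S}_1,\mathbf{F}_1$ (arity 1), $\mathbf{S}_2,\mathbf{F}_2$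 (arity 2), and program symbols $\mathsf{app}$ (arity 2) and $\mathsf{fred}$ (arity 3), with rewrite rules $\mathsf{app}(\mathbf{S}_0,x)\to\mathbf{S}_1(x)$; $\mathsf{app}(\mathbf{S}_1(x),y)\to\mathbf{S}_2(x,y)$; $\mathsf{app}(\mathbf{S}_2(x,y),z)\to\mathsf{app}(\mathsf{app}(x,z),\mathsf{app}(y,z))$; $\mathsf{app}(\mathbf{F}_0,x)\to\mathbf{F}_1(x)$; $\mathsf{app}(\mathbf{F}_1(x),y)\to\mathbf{F}_2(x,y)$; $\mathsf{app}(\mathbf{F}_2(x,y),z)\to\mathsf{fred}(x,y,z)$; $\mathsf{fred}(\mathbf{S}_0,y,z)\to y$; $\mathsf{fred}(\mathbf{F}_0,y,z)\to y$; $\mathsf{fred}(\mathbf{S}_1(x),y,z)\to\mathsf{app}(\mathsf{app}(z,\mathbf{S}_0),x)$; $\mathsf{fred}(\mathbf{F}_1(x),y,z)\to\mathsf{app}(\mathsf{app}(z,\mathbf{F}_0),x)$; $\mathsf{fred}(\mathbf{S}_2(p,q),y,z)\to\mathsf{app}(\mathsf{app}(z,\mathsf{app}(\mathbf{S}_0,p)),q)$; $\mathsf{fred}(\mathbf{F}_2(p,q),y,z)\to\mathsf{app}(\mathsf{app}(z,\mathsf{app}(\mathbf{F}_0,p)),q)$. Its one-step reduction $\rightarrow_{\mathrm{SF}^{\mathcal{C}}_{@}}$ is the closure of these rules under substitution and contexts; $\rightarrow^{\ast}$ its reflexive transitive closure. A context $\mathcal{C}$ is a term with one hole, $\mathcal{C}[t]$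 the result of filling it with $t$. Perpetuality: a term $t$ is an $\infty$-term if it has an infinite reduction sequence. A reduction step $t \to s$ is perpetual if ($t$ is an $\infty$-term implies $s$ is an $\infty$-term); a reduction sequence is perpetual if each of its steps is perpetual. The translation $[\![\cdot]\!]_{@}$: $[\![\mathbf{S}]\!]_{@}=\mathbf{S}_0$, $[\![\mathbf{F}]\!]_{@}=\mathbf{F}_0$, $[\![M\,N]\!]_{@}=\mathsf{app}([\![M]\!]_{@},[\![N]\!]_{@})$. -}

module Defs where

open import Data.Nat using (ℕ; zero; suc)
open import Data.Product using (Σ; ∃; _×_; _,_)
open import Data.Sum using (_⊎_)
open import Relation.Nullary using (¬_)
open import Relation.Binary.PropositionalEquality using (_≡_)

infixl 9 _·_
data SF : Set where
  S F : SF
  _·_ : SF → SF → SF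

data Factorable : SF → Set where
  fS   : Factorable S
  fF   : Factorable F
  fS1  : ∀ M → Factorable (S · M)
  fF1  : ∀ M → Factorable (F · M)
  fS2  : ∀ M N → Factorable (S · M · N)
  fF2  : ∀ M N → Factorable (F · M · N)

data IsOp : SF → Set where
  isS : IsOp S
  isF : IsOp F

infix 4 _⟶SF_
data _⟶SF_ : SF → SF → Set where
  sRule  : ∀ M N X → S · M · N · X ⟶SF M · X · (N · X)
  fRuleO : ∀ O M N → IsOp O → F · O · M · N ⟶SF M
  fRuleA : ∀ P Q M N → Factorable (P · Q) → F · (P · Q) · M · N ⟶SF N · P · Q
  appL   : ∀ {M M'} N → M ⟶SF M' → M · N ⟶SF M' · N
  appR   : ∀ M {N N'} → N ⟶SF N' → M · N ⟶SF M · N'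

SFNormal : SF → Set
SFNormal M = ¬ (∃ λ R → M ⟶SF R)

-- Curryfied applicative SF-calculus (first-order TRS); terms may
-- contain variables (indexed by ℕ).

data Tm : Set where
  var       : ℕ → Tm
  S₀ F₀     : Tm
  S₁ F₁     : Tm → Tm
  S₂ F₂     : Tm → Tm → Tm
  app       : Tm → Tm → Tm
  fred      : Tm → Tm → Tm → Tm

-- root rewrite steps (every instance of a rule, i.e. closure under substitution)
data _⟶root_ : Tm → Tm → Set where
  r-S0 : ∀ x → app S₀ x ⟶root S₁ x
  r-S1 : ∀ x y → app (S₁ x) y ⟶root S₂ x y
  r-S2 : ∀ x y z → app (S₂ x y) z ⟶root app (app x z) (app y z)
  r-F0 : ∀ x → app F₀ x ⟶root F₁ x
  r-F1 : ∀ x y → app (F₁ x) y ⟶root F₂ x y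
  r-F2 : ∀ x y z → app (F₂ x y) z ⟶root fred x y z
  f-S0 : ∀ y z → fred S₀ y z ⟶root y
  f-F0 : ∀ y z → fred F₀ y z ⟶root y
  f-S1 : ∀ x y z → fred (S₁ x) y z ⟶root app (app z S₀) x
  f-F1 : ∀ x y z → fred (F₁ x) y z ⟶root app (app z F₀) x
  f-S2 : ∀ p q y z → fred (S₂ p q) y z ⟶root app (app z (app S₀ p)) q
  f-F2 : ∀ p q y z → fred (F₂ p q) y z ⟶root app (app z (app F₀ p)) q

data Ctx : Set where
  □       : Ctx
  S₁-     : Ctx → Ctx
  F₁-     : Ctx → Ctx
  S₂-l    : Ctx → Tm → Ctx
  S₂-r    : Tm → Ctx → Ctx
  F₂-l    : Ctx → Tm → Ctx
  F₂-r    : Tm → Ctx → Ctx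
  app-l   : Ctx → Tm → Ctx
  app-r   : Tm → Ctx → Ctx
  fred-1  : Ctx → Tm → Tm → Ctx
  fred-2  : Tm → Ctx → Tm → Ctx
  fred-3  : Tm → Tm → Ctx → Ctx

plug : Ctx → Tm → Tm
plug □ t = t
plug (S₁- C) t = S₁ (plug C t)
plug (F₁- C) t = F₁ (plug C t)
plug (S₂-l C u) t = S₂ (plug C t) u
plug (S₂-r u C) t = S₂ u (plug C t)
plug (F₂-l C u) t = F₂ (plug C t) u
plug (F₂-r u C) t = F₂ u (plug C t)
plug (app-l C u) t = app (plug C t) u
plug (app-r u C) t = app u (plug C t)
plug (fred-1 C u v) t = fred (plug C t) u v
plug (fred-2 u C v) t = fred u (plug C t) v
plug (fred-3 u v C) t = fred u v (plug C t)

infix 4 _⟶_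
data _⟶_ : Tm → Tm → Set where
  step : ∀ (C : Ctx) {l r} → l ⟶root r → plug C l ⟶ plug C r

∞-term : Tm → Set
∞-term t = Σ (ℕ → Tm) λ f → (f 0 ≡ t) × (∀ n → f n ⟶ f (suc n))

Perpetual : Tm → Tm → Set
Perpetual t s = ∞-term t → ∞-term s

data PerpSeq : Tm → Tm → Set where
  done : ∀ t → PerpSeq t t
  _∷_  : ∀ {t u s} → (Σ (t ⟶ u) λ _ → Perpetual t u) → PerpSeq u s → PerpSeq t s

⟦_⟧ₐ : SF → Tm
⟦ S ⟧ₐ = S₀
⟦ F ⟧ₐ = F₀
⟦ M · N ⟧ₐ = app ⟦ M ⟧ₐ ⟦ N ⟧ₐ

module Submission where

-- A root step  O X M N →SF R  with SF-normal X, M, N is simulated in the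
-- curryfied system by contracting the redexes app S₀/F₀ x, app S₁/F₁ x y,
-- app S₂/F₂ x y z and, for F, a fred-redex.  App-rules erase nothing, and a
-- fred-rule only erases the translation of an SF-normal form, an "inert"
-- term with no infinite reduction; so each of these steps is perpetual.
--
-- The general fact is a simulation: write t ▷ u when u arises from t by
-- contracting marked redexes whose erased arguments are inert.  Each step
-- t → t' is matched by steps u →⁺ u' with t' ▷ u', or absorbed (t' ▷ u with
-- smaller weight), so infinite reductions of t transfer to u.

open import Defs
open import Data.Nat using (ℕ; zero; suc; _+_; _<_; _≤_; s≤s; s≤s⁻¹)
open import Data.Nat.Properties using (+-monoˡ-<; +-monoʳ-<; m≤m+n; n<1+n; ≤-trans; <⇒≤; +-identityʳ)
open import Data.Product using (Σ; _×_; _,_; proj₁; proj₂)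
open import Data.Empty using (⊥-elim)
open import Relation.Nullary using (¬_)
open import Relation.Binary.PropositionalEquality using (refl; subst; sym)
open import Relation.Binary.Construct.Closure.ReflexiveTransitive using (Star; ε; _◅_; _◅◅_; gmap)

-- 1. One-step reduction as a congruence

-- A root step, or a step inside one argument of a symbol.  This is the
-- structural form of _⟶_ that the simulation recurses on.
infix 4 _⇒_ _⇒*_ _⇒⁺_
data _⇒_ : Tm → Tm → Set where
  root    : ∀ {l r} → l ⟶root r → l ⇒ r
  inS₁    : ∀ {x x'} → x ⇒ x' → S₁ x ⇒ S₁ x'
  inF₁    : ∀ {x x'} → x ⇒ x' → F₁ x ⇒ F₁ x'
  inS₂ˡ   : ∀ {x x' y} → x ⇒ x' → S₂ x y ⇒ S₂ x' y
  inS₂ʳ   : ∀ {x y y'} → y ⇒ y' → S₂ x y ⇒ S₂ x y'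
  inF₂ˡ   : ∀ {x x' y} → x ⇒ x' → F₂ x y ⇒ F₂ x' y
  inF₂ʳ   : ∀ {x y y'} → y ⇒ y' → F₂ x y ⇒ F₂ x y'
  inAppˡ  : ∀ {x x' y} → x ⇒ x' → app x y ⇒ app x' y
  inAppʳ  : ∀ {x y y'} → y ⇒ y' → app x y ⇒ app x y'
  inFred₁ : ∀ {x x' y z} → x ⇒ x' → fred x y z ⇒ fred x' y z
  inFred₂ : ∀ {x y y' z} → y ⇒ y' → fred x y z ⇒ fred x y' z
  inFred₃ : ∀ {x y z z'} → z ⇒ z' → fred x y z ⇒ fred x y z'

_⇒*_ : Tm → Tm → Set
_⇒*_ = Star _⇒_

data _⇒⁺_ (a c : Tm) : Set where
  _◅⁺_ : ∀ {b} → a ⇒ b → b ⇒* c → a ⇒⁺ c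

single : ∀ {a b} → a ⇒ b → a ⇒⁺ b
single s = s ◅⁺ ε

_++⁺_ : ∀ {a b c} → a ⇒⁺ b → b ⇒⁺ c → a ⇒⁺ c
(s ◅⁺ ss) ++⁺ (t ◅⁺ ts) = s ◅⁺ (ss ◅◅ (t ◅ ts))

map⁺ : (G : Tm → Tm) → (∀ {x y} → x ⇒ y → G x ⇒ G y) → ∀ {a b} → a ⇒⁺ b → G a ⇒⁺ G b
map⁺ G g (s ◅⁺ ss) = g s ◅⁺ gmap G g ss

plug-⇒ : ∀ C {a b} → a ⇒ b → plug C a ⇒ plug C b
plug-⇒ □ s = s
plug-⇒ (S₁- C) s = inS₁ (plug-⇒ C s)
plug-⇒ (F₁- C) s = inF₁ (plug-⇒ C s)
plug-⇒ (S₂-l C u) s = inS₂ˡ (plug-⇒ C s)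
plug-⇒ (S₂-r u C) s = inS₂ʳ (plug-⇒ C s)
plug-⇒ (F₂-l C u) s = inF₂ˡ (plug-⇒ C s)
plug-⇒ (F₂-r u C) s = inF₂ʳ (plug-⇒ C s)
plug-⇒ (app-l C u) s = inAppˡ (plug-⇒ C s)
plug-⇒ (app-r u C) s = inAppʳ (plug-⇒ C s)
plug-⇒ (fred-1 C u v) s = inFred₁ (plug-⇒ C s)
plug-⇒ (fred-2 u C v) s = inFred₂ (plug-⇒ C s)
plug-⇒ (fred-3 u v C) s = inFred₃ (plug-⇒ C s)

⟶⇒⇒ : ∀ {a b} → a ⟶ b → a ⇒ b
⟶⇒⇒ (step C ρ) = plug-⇒ C (root ρ)

⇒⇒⟶ : ∀ {a b} → a ⇒ b → a ⟶ b
⇒⇒⟶ (root ρ) = step □ ρ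
⇒⇒⟶ (inS₁ s) with ⇒⇒⟶ s
... | step C ρ = step (S₁- C) ρ
⇒⇒⟶ (inF₁ s) with ⇒⇒⟶ s
... | step C ρ = step (F₁- C) ρ
⇒⇒⟶ (inS₂ˡ {y = y} s) with ⇒⇒⟶ s
... | step C ρ = step (S₂-l C y) ρ
⇒⇒⟶ (inS₂ʳ {x = x} s) with ⇒⇒⟶ s
... | step C ρ = step (S₂-r x C) ρ
⇒⇒⟶ (inF₂ˡ {y = y} s) with ⇒⇒⟶ s
... | step C ρ = step (F₂-l C y) ρ
⇒⇒⟶ (inF₂ʳ {x = x} s) with ⇒⇒⟶ s
... | step C ρ = step (F₂-r x C) ρ
⇒⇒⟶ (inAppˡ {y = y} s) with ⇒⇒⟶ s
... | step C ρ = step (app-l C y) ρ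
⇒⇒⟶ (inAppʳ {x = x} s) with ⇒⇒⟶ s
... | step C ρ = step (app-r x C) ρ
⇒⇒⟶ (inFred₁ {y = y} {z = z} s) with ⇒⇒⟶ s
... | step C ρ = step (fred-1 C y z) ρ
⇒⇒⟶ (inFred₂ {x = x} {z = z} s) with ⇒⇒⟶ s
... | step C ρ = step (fred-2 x C z) ρ
⇒⇒⟶ (inFred₃ {x = x} {y = y} s) with ⇒⇒⟶ s
... | step C ρ = step (fred-3 x y C) ρ

-- 2. Inert terms

-- Number of app symbols; it bounds the length of reductions of inert terms.
apps : Tm → ℕ
apps (var n) = 0
apps S₀ = 0
apps F₀ = 0
apps (S₁ x) = apps x
apps (F₁ x) = apps x
apps (S₂ x y) = apps x + apps y
apps (F₂ x y) = apps x + apps y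
apps (app x y) = suc (apps x + apps y)
apps (fred x y z) = apps x + apps y + apps z

-- Translations of SF-normal forms together with their reducts: constructor
-- terms in which app only occurs as a partial application of S₀ or F₀.
data Inert : Tm → Set where
  S₀    : Inert S₀
  F₀    : Inert F₀
  S₁    : ∀ {x} → Inert x → Inert (S₁ x)
  F₁    : ∀ {x} → Inert x → Inert (F₁ x)
  S₂    : ∀ {x y} → Inert x → Inert y → Inert (S₂ x y)
  F₂    : ∀ {x y} → Inert x → Inert y → Inert (F₂ x y)
  S₀·   : ∀ {x} → Inert x → Inert (app S₀ x)
  F₀·   : ∀ {x} → Inert x → Inert (app F₀ x)
  S₁·   : ∀ {x y} → Inert x → Inert y → Inert (app (S₁ x) y)
  F₁·   : ∀ {x y} → Inert x → Inert y → Inert (app (F₁ x) y)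
  S₀··  : ∀ {x y} → Inert x → Inert y → Inert (app (app S₀ x) y)
  F₀··  : ∀ {x y} → Inert x → Inert y → Inert (app (app F₀ x) y)

inert-step : ∀ {a b} → Inert a → a ⇒ b → Inert b × apps b < apps a
inert-step (S₁ w) (inS₁ s) = let (w' , l) = inert-step w s in S₁ w' , l
inert-step (F₁ w) (inF₁ s) = let (w' , l) = inert-step w s in F₁ w' , l
inert-step (S₂ wx wy) (inS₂ˡ s) = let (w' , l) = inert-step wx s in S₂ w' wy , +-monoˡ-< _ l
inert-step (S₂ wx wy) (inS₂ʳ s) = let (w' , l) = inert-step wy s in S₂ wx w' , +-monoʳ-< _ l
inert-step (F₂ wx wy) (inF₂ˡ s) = let (w' , l) = inert-step wx s in F₂ w' wy , +-monoˡ-< _ l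
inert-step (F₂ wx wy) (inF₂ʳ s) = let (w' , l) = inert-step wy s in F₂ wx w' , +-monoʳ-< _ l
inert-step (S₀· w) (root (r-S0 _)) = S₁ w , n<1+n _
inert-step (S₀· w) (inAppʳ s) = let (w' , l) = inert-step w s in S₀· w' , s≤s l
inert-step (F₀· w) (root (r-F0 _)) = F₁ w , n<1+n _
inert-step (F₀· w) (inAppʳ s) = let (w' , l) = inert-step w s in F₀· w' , s≤s l
inert-step (S₁· wx wy) (root (r-S1 _ _)) = S₂ wx wy , n<1+n _
inert-step (S₁· wx wy) (inAppˡ (inS₁ s)) = let (w' , l) = inert-step wx s in S₁· w' wy , s≤s (+-monoˡ-< _ l)
inert-step (S₁· wx wy) (inAppʳ s) = let (w' , l) = inert-step wy s in S₁· wx w' , s≤s (+-monoʳ-< _ l)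
inert-step (F₁· wx wy) (root (r-F1 _ _)) = F₂ wx wy , n<1+n _
inert-step (F₁· wx wy) (inAppˡ (inF₁ s)) = let (w' , l) = inert-step wx s in F₁· w' wy , s≤s (+-monoˡ-< _ l)
inert-step (F₁· wx wy) (inAppʳ s) = let (w' , l) = inert-step wy s in F₁· wx w' , s≤s (+-monoʳ-< _ l)
inert-step (S₀·· {x} {y} wx wy) (inAppˡ (root (r-S0 _))) = S₁· wx wy , s≤s (+-monoˡ-< (apps y) (n<1+n (apps x)))
inert-step (S₀·· wx wy) (inAppˡ (inAppʳ s)) = let (w' , l) = inert-step wx s in S₀·· w' wy , s≤s (+-monoˡ-< _ (s≤s l))
inert-step (S₀·· _ _) (inAppˡ (inAppˡ (root ())))
inert-step (S₀·· wx wy) (inAppʳ s) = let (w' , l) = inert-step wy s in S₀·· wx w' , s≤s (+-monoʳ-< _ l)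
inert-step (F₀·· {x} {y} wx wy) (inAppˡ (root (r-F0 _))) = F₁· wx wy , s≤s (+-monoˡ-< (apps y) (n<1+n (apps x)))
inert-step (F₀·· wx wy) (inAppˡ (inAppʳ s)) = let (w' , l) = inert-step wx s in F₀·· w' wy , s≤s (+-monoˡ-< _ (s≤s l))
inert-step (F₀·· _ _) (inAppˡ (inAppˡ (root ())))
inert-step (F₀·· wx wy) (inAppʳ s) = let (w' , l) = inert-step wy s in F₀·· wx w' , s≤s (+-monoʳ-< _ l)

-- 3. The development relation and the simulation lemma

-- t ▷ u : u arises from t by contracting marked redexes.  _▷_ is the
-- congruence closure of the marks _▷ₐ_ (redexes of the non-erasing app-rules)
-- and _▷f_ (redexes of the fred-rules, whose erased argument must be inert).
-- The S₂-rule copies its argument z; the two copies may later diverge, so the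
-- mark relates z separately to both of them.
infix 4 _▷_ _▷ₐ_ _▷f_
data _▷_ : Tm → Tm → Set
data _▷ₐ_ : Tm → Tm → Set
data _▷f_ : Tm → Tm → Set

data _▷_ where
  var▷  : ∀ n → var n ▷ var n
  S₀▷   : S₀ ▷ S₀
  F₀▷   : F₀ ▷ F₀
  S₁▷   : ∀ {x x'} → x ▷ x' → S₁ x ▷ S₁ x'
  F₁▷   : ∀ {x x'} → x ▷ x' → F₁ x ▷ F₁ x'
  S₂▷   : ∀ {x x' y y'} → x ▷ x' → y ▷ y' → S₂ x y ▷ S₂ x' y'
  F₂▷   : ∀ {x x' y y'} → x ▷ x' → y ▷ y' → F₂ x y ▷ F₂ x' y'
  app▷  : ∀ {x x' y y'} → x ▷ x' → y ▷ y' → app x y ▷ app x' y'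
  fred▷ : ∀ {x x' y y' z z'} → x ▷ x' → y ▷ y' → z ▷ z' → fred x y z ▷ fred x' y' z'
  ▷app  : ∀ {t u} → t ▷ₐ u → t ▷ u
  ▷fred : ∀ {t u} → t ▷f u → t ▷ u

data _▷ₐ_ where
  S₀-app : ∀ {x x'} → x ▷ x' → app S₀ x ▷ₐ S₁ x'
  F₀-app : ∀ {x x'} → x ▷ x' → app F₀ x ▷ₐ F₁ x'
  S₁-app : ∀ {x x' y y'} → x ▷ x' → y ▷ y' → app (S₁ x) y ▷ₐ S₂ x' y'
  F₁-app : ∀ {x x' y y'} → x ▷ x' → y ▷ y' → app (F₁ x) y ▷ₐ F₂ x' y'
  S₂-app : ∀ {x x' y y' z z₁ z₂} → x ▷ x' → y ▷ y' → z ▷ z₁ → z ▷ z₂ →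
           app (S₂ x y) z ▷ₐ app (app x' z₁) (app y' z₂)
  F₂-app : ∀ {x x' y y' z z'} → x ▷ x' → y ▷ y' → z ▷ z' → app (F₂ x y) z ▷ₐ fred x' y' z'

data _▷f_ where
  S₀-fred : ∀ {y y' z} → y ▷ y' → Inert z → fred S₀ y z ▷f y'
  F₀-fred : ∀ {y y' z} → y ▷ y' → Inert z → fred F₀ y z ▷f y'
  S₁-fred : ∀ {x x' y z z'} → x ▷ x' → Inert y → z ▷ z' → fred (S₁ x) y z ▷f app (app z' S₀) x'
  F₁-fred : ∀ {x x' y z z'} → x ▷ x' → Inert y → z ▷ z' → fred (F₁ x) y z ▷f app (app z' F₀) x'
  S₂-fred : ∀ {p p' q q' y z z'} → p ▷ p' → q ▷ q' → Inert y → z ▷ z' →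
            fred (S₂ p q) y z ▷f app (app z' (app S₀ p')) q'
  F₂-fred : ∀ {p p' q q' y z z'} → p ▷ p' → q ▷ q' → Inert y → z ▷ z' →
            fred (F₂ p q) y z ▷f app (app z' (app F₀ p')) q'

-- The weight counts the marks and the app symbols of the erased arguments.
-- It strictly decreases along source steps that the target does not mirror.
weight  : ∀ {t u} → t ▷ u → ℕ
weightₐ : ∀ {t u} → t ▷ₐ u → ℕ
weightf : ∀ {t u} → t ▷f u → ℕ

weight (var▷ n) = 0
weight S₀▷ = 0
weight F₀▷ = 0
weight (S₁▷ a) = weight a
weight (F₁▷ a) = weight a
weight (S₂▷ a b) = weight a + weight b
weight (F₂▷ a b) = weight a + weight b
weight (app▷ a b) = weight a + weight b
weight (fred▷ a b c) = weight a + weight b + weight c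
weight (▷app m) = weightₐ m
weight (▷fred m) = weightf m

weightₐ (S₀-app a) = suc (weight a)
weightₐ (F₀-app a) = suc (weight a)
weightₐ (S₁-app a b) = suc (weight a + weight b)
weightₐ (F₁-app a b) = suc (weight a + weight b)
weightₐ (S₂-app a b c d) = suc ((weight a + weight c) + (weight b + weight d))
weightₐ (F₂-app a b c) = suc (weight a + weight b + weight c)

weightf (S₀-fred {z = z} a w) = suc (weight a + apps z)
weightf (F₀-fred {z = z} a w) = suc (weight a + apps z)
weightf (S₁-fred {y = y} a w c) = suc (weight c + weight a + apps y)
weightf (F₁-fred {y = y} a w c) = suc (weight c + weight a + apps y)
weightf (S₂-fred {y = y} a b w c) = suc (weight c + weight a + weight b + apps y)
weightf (F₂-fred {y = y} a b w c) = suc (weight c + weight a + weight b + apps y)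

data Simulated (t' u : Tm) (m : ℕ) : Set where
  matched  : ∀ {u'} → u ⇒⁺ u' → t' ▷ u' → Simulated t' u m
  absorbed : (e : t' ▷ u) → weight e < m → Simulated t' u m

under : ∀ {a' b T' m n} (G : Tm → Tm) → (∀ {x y} → x ⇒ y → G x ⇒ G y) →
        (K : ∀ {b'} → a' ▷ b' → T' ▷ G b') →
        (∀ (e : a' ▷ b) → weight e < n → weight (K e) < m) →
        Simulated a' b n → Simulated T' (G b) m
under G g K mono (matched p e) = matched (map⁺ G g p) (K e)
under G g K mono (absorbed e l) = absorbed (K e) (mono e l)

simulate  : ∀ {t t' u} (d : t ▷ u) → t ⇒ t' → Simulated t' u (weight d)
simulateₐ : ∀ {t t' u} (m : t ▷ₐ u) → t ⇒ t' → Simulated t' u (weightₐ m)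
simulatef : ∀ {t t' u} (m : t ▷f u) → t ⇒ t' → Simulated t' u (weightf m)

simulate (var▷ n) (root ())
simulate S₀▷ (root ())
simulate F₀▷ (root ())
simulate (S₁▷ a) (inS₁ s) = under S₁ inS₁ S₁▷ (λ _ l → l) (simulate a s)
simulate (F₁▷ a) (inF₁ s) = under F₁ inF₁ F₁▷ (λ _ l → l) (simulate a s)
simulate (S₂▷ {y' = y'} a b) (inS₂ˡ s) =
  under (λ x → S₂ x y') inS₂ˡ (λ e → S₂▷ e b) (λ _ l → +-monoˡ-< (weight b) l) (simulate a s)
simulate (S₂▷ {x' = x'} a b) (inS₂ʳ s) =
  under (S₂ x') inS₂ʳ (S₂▷ a) (λ _ l → +-monoʳ-< (weight a) l) (simulate b s)
simulate (F₂▷ {y' = y'} a b) (inF₂ˡ s) =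
  under (λ x → F₂ x y') inF₂ˡ (λ e → F₂▷ e b) (λ _ l → +-monoˡ-< (weight b) l) (simulate a s)
simulate (F₂▷ {x' = x'} a b) (inF₂ʳ s) =
  under (F₂ x') inF₂ʳ (F₂▷ a) (λ _ l → +-monoʳ-< (weight a) l) (simulate b s)
simulate (app▷ {y' = y'} a b) (inAppˡ s) =
  under (λ x → app x y') inAppˡ (λ e → app▷ e b) (λ _ l → +-monoˡ-< (weight b) l) (simulate a s)
simulate (app▷ {x' = x'} a b) (inAppʳ s) =
  under (app x') inAppʳ (app▷ a) (λ _ l → +-monoʳ-< (weight a) l) (simulate b s)
simulate (fred▷ {y' = y'} {z' = z'} a b c) (inFred₁ s) =
  under (λ x → fred x y' z') inFred₁ (λ e → fred▷ e b c)
        (λ _ l → +-monoˡ-< (weight c) (+-monoˡ-< (weight b) l)) (simulate a s)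
simulate (fred▷ {x' = x'} {z' = z'} a b c) (inFred₂ s) =
  under (λ y → fred x' y z') inFred₂ (λ e → fred▷ a e c)
        (λ _ l → +-monoˡ-< (weight c) (+-monoʳ-< (weight a) l)) (simulate b s)
simulate (fred▷ {x' = x'} {y' = y'} a b c) (inFred₃ s) =
  under (fred x' y') inFred₃ (fred▷ a b) (λ _ l → +-monoʳ-< (weight a + weight b) l) (simulate c s)
simulate (app▷ S₀▷ b) (root (r-S0 _)) = matched (single (root (r-S0 _))) (S₁▷ b)
simulate (app▷ F₀▷ b) (root (r-F0 _)) = matched (single (root (r-F0 _))) (F₁▷ b)
simulate (app▷ (S₁▷ a) b) (root (r-S1 _ _)) = matched (single (root (r-S1 _ _))) (S₂▷ a b)
simulate (app▷ (F₁▷ a) b) (root (r-F1 _ _)) = matched (single (root (r-F1 _ _))) (F₂▷ a b)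
simulate (app▷ (S₂▷ a c) b) (root (r-S2 _ _ _)) =
  matched (single (root (r-S2 _ _ _))) (app▷ (app▷ a b) (app▷ c b))
simulate (app▷ (F₂▷ a c) b) (root (r-F2 _ _ _)) = matched (single (root (r-F2 _ _ _))) (fred▷ a c b)
simulate (fred▷ S₀▷ b c) (root (f-S0 _ _)) = matched (single (root (f-S0 _ _))) b
simulate (fred▷ F₀▷ b c) (root (f-F0 _ _)) = matched (single (root (f-F0 _ _))) b
simulate (fred▷ (S₁▷ a) b c) (root (f-S1 _ _ _)) =
  matched (single (root (f-S1 _ _ _))) (app▷ (app▷ c S₀▷) a)
simulate (fred▷ (F₁▷ a) b c) (root (f-F1 _ _ _)) =
  matched (single (root (f-F1 _ _ _))) (app▷ (app▷ c F₀▷) a)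
simulate (fred▷ (S₂▷ p q) b c) (root (f-S2 _ _ _ _)) =
  matched (single (root (f-S2 _ _ _ _))) (app▷ (app▷ c (app▷ S₀▷ p)) q)
simulate (fred▷ (F₂▷ p q) b c) (root (f-F2 _ _ _ _)) =
  matched (single (root (f-F2 _ _ _ _))) (app▷ (app▷ c (app▷ F₀▷ p)) q)
simulate (▷app m) s = simulateₐ m s
simulate (▷fred m) s = simulatef m s

-- Marked app-redexes: contracting the mark itself is absorbed (the weight drops
-- by one); every other step happens inside arguments.  An argument step below
-- the copied argument of an S₂-mark is simulated in both copies.
simulateₐ (S₀-app a) (root (r-S0 _)) = absorbed (S₁▷ a) (n<1+n _)
simulateₐ (S₀-app a) (inAppˡ (root ()))
simulateₐ (S₀-app a) (inAppʳ s) = under S₁ inS₁ (λ e → ▷app (S₀-app e)) (λ _ l → s≤s l) (simulate a s)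
simulateₐ (F₀-app a) (root (r-F0 _)) = absorbed (F₁▷ a) (n<1+n _)
simulateₐ (F₀-app a) (inAppˡ (root ()))
simulateₐ (F₀-app a) (inAppʳ s) = under F₁ inF₁ (λ e → ▷app (F₀-app e)) (λ _ l → s≤s l) (simulate a s)
simulateₐ (S₁-app a b) (root (r-S1 _ _)) = absorbed (S₂▷ a b) (n<1+n _)
simulateₐ (S₁-app {y' = y'} a b) (inAppˡ (inS₁ s)) =
  under (λ x → S₂ x y') inS₂ˡ (λ e → ▷app (S₁-app e b)) (λ _ l → s≤s (+-monoˡ-< (weight b) l)) (simulate a s)
simulateₐ (S₁-app {x' = x'} a b) (inAppʳ s) =
  under (S₂ x') inS₂ʳ (λ e → ▷app (S₁-app a e)) (λ _ l → s≤s (+-monoʳ-< (weight a) l)) (simulate b s)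
simulateₐ (F₁-app a b) (root (r-F1 _ _)) = absorbed (F₂▷ a b) (n<1+n _)
simulateₐ (F₁-app {y' = y'} a b) (inAppˡ (inF₁ s)) =
  under (λ x → F₂ x y') inF₂ˡ (λ e → ▷app (F₁-app e b)) (λ _ l → s≤s (+-monoˡ-< (weight b) l)) (simulate a s)
simulateₐ (F₁-app {x' = x'} a b) (inAppʳ s) =
  under (F₂ x') inF₂ʳ (λ e → ▷app (F₁-app a e)) (λ _ l → s≤s (+-monoʳ-< (weight a) l)) (simulate b s)
simulateₐ (S₂-app a b c d) (root (r-S2 _ _ _)) = absorbed (app▷ (app▷ a c) (app▷ b d)) (n<1+n _)
simulateₐ (S₂-app {y' = y'} {z₁ = z₁} {z₂ = z₂} a b c d) (inAppˡ (inS₂ˡ s)) =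
  under (λ x → app (app x z₁) (app y' z₂)) (λ st → inAppˡ (inAppˡ st)) (λ e → ▷app (S₂-app e b c d))
        (λ _ l → s≤s (+-monoˡ-< (weight b + weight d) (+-monoˡ-< (weight c) l))) (simulate a s)
simulateₐ (S₂-app {x' = x'} {z₁ = z₁} {z₂ = z₂} a b c d) (inAppˡ (inS₂ʳ s)) =
  under (λ y → app (app x' z₁) (app y z₂)) (λ st → inAppʳ (inAppˡ st)) (λ e → ▷app (S₂-app a e c d))
        (λ _ l → s≤s (+-monoʳ-< (weight a + weight c) (+-monoˡ-< (weight d) l))) (simulate b s)
simulateₐ (S₂-app {x' = x'} {y' = y'} {z₁ = z₁} {z₂ = z₂} a b c d) (inAppʳ s)
  with simulate c s | simulate d s
... | absorbed c' l₁ | absorbed d' l₂ =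
  absorbed (▷app (S₂-app a b c' d'))
           (s≤s (≤-trans (+-monoˡ-< (weight b + weight d') (+-monoʳ-< (weight a) l₁))
                         (<⇒≤ (+-monoʳ-< (weight a + weight c) (+-monoʳ-< (weight b) l₂)))))
... | matched p₁ c' | absorbed d' _ =
  matched (map⁺ (λ z → app (app x' z) (app y' z₂)) (λ st → inAppˡ (inAppʳ st)) p₁) (▷app (S₂-app a b c' d'))
... | absorbed c' _ | matched p₂ d' =
  matched (map⁺ (λ z → app (app x' z₁) (app y' z)) (λ st → inAppʳ (inAppʳ st)) p₂) (▷app (S₂-app a b c' d'))
... | matched {u₁} p₁ c' | matched p₂ d' =
  matched (map⁺ (λ z → app (app x' z) (app y' z₂)) (λ st → inAppˡ (inAppʳ st)) p₁ ++⁺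
           map⁺ (λ z → app (app x' u₁) (app y' z)) (λ st → inAppʳ (inAppʳ st)) p₂)
          (▷app (S₂-app a b c' d'))
simulateₐ (F₂-app a b c) (root (r-F2 _ _ _)) = absorbed (fred▷ a b c) (n<1+n _)
simulateₐ (F₂-app {y' = y'} {z' = z'} a b c) (inAppˡ (inF₂ˡ s)) =
  under (λ x → fred x y' z') inFred₁ (λ e → ▷app (F₂-app e b c))
        (λ _ l → s≤s (+-monoˡ-< (weight c) (+-monoˡ-< (weight b) l))) (simulate a s)
simulateₐ (F₂-app {x' = x'} {z' = z'} a b c) (inAppˡ (inF₂ʳ s)) =
  under (λ y → fred x' y z') inFred₂ (λ e → ▷app (F₂-app a e c))
        (λ _ l → s≤s (+-monoˡ-< (weight c) (+-monoʳ-< (weight a) l))) (simulate b s)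
simulateₐ (F₂-app {x' = x'} {y' = y'} a b c) (inAppʳ s) =
  under (fred x' y') inFred₃ (λ e → ▷app (F₂-app a b e))
        (λ _ l → s≤s (+-monoʳ-< (weight a + weight b) l)) (simulate c s)

-- The contractum  app (app c O) a  of an S₁/F₁ fred-mark has weight c + 0 + a.
contractum-weight : ∀ c a k → c + 0 + a ≤ c + a + k
contractum-weight c a k = subst (λ n → n + a ≤ c + a + k) (sym (+-identityʳ c)) (m≤m+n (c + a) k)

-- Marked fred-redexes: contracting the mark, or reducing inside the erased
-- inert argument, is absorbed; other steps are simulated inside arguments.
simulatef (S₀-fred {z = z} a w) (root (f-S0 _ _)) = absorbed a (s≤s (m≤m+n _ (apps z)))
simulatef (S₀-fred a w) (inFred₁ (root ()))
simulatef (S₀-fred {z = z} a w) (inFred₂ s) =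
  under (λ y → y) (λ st → st) (λ e → ▷fred (S₀-fred e w)) (λ _ l → s≤s (+-monoˡ-< (apps z) l)) (simulate a s)
simulatef (S₀-fred a w) (inFred₃ s) =
  let (w' , l) = inert-step w s in absorbed (▷fred (S₀-fred a w')) (s≤s (+-monoʳ-< (weight a) l))
simulatef (F₀-fred {z = z} a w) (root (f-F0 _ _)) = absorbed a (s≤s (m≤m+n _ (apps z)))
simulatef (F₀-fred a w) (inFred₁ (root ()))
simulatef (F₀-fred {z = z} a w) (inFred₂ s) =
  under (λ y → y) (λ st → st) (λ e → ▷fred (F₀-fred e w)) (λ _ l → s≤s (+-monoˡ-< (apps z) l)) (simulate a s)
simulatef (F₀-fred a w) (inFred₃ s) =
  let (w' , l) = inert-step w s in absorbed (▷fred (F₀-fred a w')) (s≤s (+-monoʳ-< (weight a) l))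
simulatef (S₁-fred {y = y} a w c) (root (f-S1 _ _ _)) =
  absorbed (app▷ (app▷ c S₀▷) a) (s≤s (contractum-weight (weight c) (weight a) (apps y)))
simulatef (S₁-fred {y = y} {z' = z'} a w c) (inFred₁ (inS₁ s)) =
  under (app (app z' S₀)) inAppʳ (λ e → ▷fred (S₁-fred e w c))
        (λ _ l → s≤s (+-monoˡ-< (apps y) (+-monoʳ-< (weight c) l))) (simulate a s)
simulatef (S₁-fred a w c) (inFred₂ s) =
  let (w' , l) = inert-step w s in absorbed (▷fred (S₁-fred a w' c)) (s≤s (+-monoʳ-< (weight c + weight a) l))
simulatef (S₁-fred {x' = x'} {y = y} a w c) (inFred₃ s) =
  under (λ z → app (app z S₀) x') (λ st → inAppˡ (inAppˡ st)) (λ e → ▷fred (S₁-fred a w e))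
        (λ _ l → s≤s (+-monoˡ-< (apps y) (+-monoˡ-< (weight a) l))) (simulate c s)
simulatef (F₁-fred {y = y} a w c) (root (f-F1 _ _ _)) =
  absorbed (app▷ (app▷ c F₀▷) a) (s≤s (contractum-weight (weight c) (weight a) (apps y)))
simulatef (F₁-fred {y = y} {z' = z'} a w c) (inFred₁ (inF₁ s)) =
  under (app (app z' F₀)) inAppʳ (λ e → ▷fred (F₁-fred e w c))
        (λ _ l → s≤s (+-monoˡ-< (apps y) (+-monoʳ-< (weight c) l))) (simulate a s)
simulatef (F₁-fred a w c) (inFred₂ s) =
  let (w' , l) = inert-step w s in absorbed (▷fred (F₁-fred a w' c)) (s≤s (+-monoʳ-< (weight c + weight a) l))
simulatef (F₁-fred {x' = x'} {y = y} a w c) (inFred₃ s) =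
  under (λ z → app (app z F₀) x') (λ st → inAppˡ (inAppˡ st)) (λ e → ▷fred (F₁-fred a w e))
        (λ _ l → s≤s (+-monoˡ-< (apps y) (+-monoˡ-< (weight a) l))) (simulate c s)
simulatef (S₂-fred {y = y} a b w c) (root (f-S2 _ _ _ _)) =
  absorbed (app▷ (app▷ c (app▷ S₀▷ a)) b) (s≤s (m≤m+n _ (apps y)))
simulatef (S₂-fred {q' = q'} {y = y} {z' = z'} a b w c) (inFred₁ (inS₂ˡ s)) =
  under (λ p → app (app z' (app S₀ p)) q') (λ st → inAppˡ (inAppʳ (inAppʳ st))) (λ e → ▷fred (S₂-fred e b w c))
        (λ _ l → s≤s (+-monoˡ-< (apps y) (+-monoˡ-< (weight b) (+-monoʳ-< (weight c) l)))) (simulate a s)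
simulatef (S₂-fred {p' = p'} {y = y} {z' = z'} a b w c) (inFred₁ (inS₂ʳ s)) =
  under (app (app z' (app S₀ p'))) inAppʳ (λ e → ▷fred (S₂-fred a e w c))
        (λ _ l → s≤s (+-monoˡ-< (apps y) (+-monoʳ-< (weight c + weight a) l))) (simulate b s)
simulatef (S₂-fred a b w c) (inFred₂ s) =
  let (w' , l) = inert-step w s
  in absorbed (▷fred (S₂-fred a b w' c)) (s≤s (+-monoʳ-< (weight c + weight a + weight b) l))
simulatef (S₂-fred {p' = p'} {q' = q'} {y = y} a b w c) (inFred₃ s) =
  under (λ z → app (app z (app S₀ p')) q') (λ st → inAppˡ (inAppˡ st)) (λ e → ▷fred (S₂-fred a b w e))
        (λ _ l → s≤s (+-monoˡ-< (apps y) (+-monoˡ-< (weight b) (+-monoˡ-< (weight a) l)))) (simulate c s)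
simulatef (F₂-fred {y = y} a b w c) (root (f-F2 _ _ _ _)) =
  absorbed (app▷ (app▷ c (app▷ F₀▷ a)) b) (s≤s (m≤m+n _ (apps y)))
simulatef (F₂-fred {q' = q'} {y = y} {z' = z'} a b w c) (inFred₁ (inF₂ˡ s)) =
  under (λ p → app (app z' (app F₀ p)) q') (λ st → inAppˡ (inAppʳ (inAppʳ st))) (λ e → ▷fred (F₂-fred e b w c))
        (λ _ l → s≤s (+-monoˡ-< (apps y) (+-monoˡ-< (weight b) (+-monoʳ-< (weight c) l)))) (simulate a s)
simulatef (F₂-fred {p' = p'} {y = y} {z' = z'} a b w c) (inFred₁ (inF₂ʳ s)) =
  under (app (app z' (app F₀ p'))) inAppʳ (λ e → ▷fred (F₂-fred a e w c))
        (λ _ l → s≤s (+-monoˡ-< (apps y) (+-monoʳ-< (weight c + weight a) l))) (simulate b s)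
simulatef (F₂-fred a b w c) (inFred₂ s) =
  let (w' , l) = inert-step w s
  in absorbed (▷fred (F₂-fred a b w' c)) (s≤s (+-monoʳ-< (weight c + weight a + weight b) l))
simulatef (F₂-fred {p' = p'} {q' = q'} {y = y} a b w c) (inFred₃ s) =
  under (λ z → app (app z (app F₀ p')) q') (λ st → inAppˡ (inAppˡ st)) (λ e → ▷fred (F₂-fred a b w e))
        (λ _ l → s≤s (+-monoˡ-< (apps y) (+-monoˡ-< (weight b) (+-monoˡ-< (weight a) l)))) (simulate c s)

-- 4. Transfer of infinite reductions along _▷_

module Transfer (f : ℕ → Tm) (f-step : ∀ n → f n ⇒ f (suc n)) where

  -- Following f from position i, the target must move within weight + 1
  -- steps, because every absorbed step lowers the weight.
  catch-up : ∀ k i {u} (d : f i ▷ u) → weight d < k →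
             Σ ℕ λ j → Σ Tm λ u' → (u ⇒⁺ u') × (f j ▷ u')
  catch-up (suc k) i d lt with simulate d (f-step i)
  ... | matched p d' = suc i , _ , p , d'
  ... | absorbed d' lt' = catch-up k (suc i) d' (≤-trans lt' (s≤s⁻¹ lt))

  -- The new sequence is at  current ; a pending reduction leads from it to a
  -- term that is related to the source sequence at position  index .
  record State : Set where
    constructor state
    field
      index   : ℕ
      current : Tm
      goal    : Tm
      pending : current ⇒* goal
      related : f index ▷ goal
  open State

  advance : (s : State) → Σ State λ s' → current s ⇒ current s'
  advance (state i _ u (x ◅ p) d) = state i _ u p d , x
  advance (state i _ _ ε d) with catch-up (suc (weight d)) i d (n<1+n _)
  ... | j , u' , (x ◅⁺ p) , d' = state j _ u' p d' , x

  states : State → ℕ → State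
  states s zero = s
  states s (suc n) = proj₁ (advance (states s n))

▷-∞ : ∀ {t u} → t ▷ u → ∞-term t → ∞-term u
▷-∞ {t} {u} d (f , f0≡t , f-step) =
  (λ n → current (states start n)) , refl , (λ n → ⇒⇒⟶ (proj₂ (advance (states start n))))
  where
    open Transfer f (λ n → ⟶⇒⇒ (f-step n))
    open State
    start : State
    start = state 0 u u ε (subst (_▷ u) (sym f0≡t) d)

▷-refl : ∀ t → t ▷ t
▷-refl (var n) = var▷ n
▷-refl S₀ = S₀▷
▷-refl F₀ = F₀▷
▷-refl (S₁ x) = S₁▷ (▷-refl x)
▷-refl (F₁ x) = F₁▷ (▷-refl x)
▷-refl (S₂ x y) = S₂▷ (▷-refl x) (▷-refl y)
▷-refl (F₂ x y) = F₂▷ (▷-refl x) (▷-refl y)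
▷-refl (app x y) = app▷ (▷-refl x) (▷-refl y)
▷-refl (fred x y z) = fred▷ (▷-refl x) (▷-refl y) (▷-refl z)

plug-▷ : ∀ C {a b} → a ▷ b → plug C a ▷ plug C b
plug-▷ □ d = d
plug-▷ (S₁- C) d = S₁▷ (plug-▷ C d)
plug-▷ (F₁- C) d = F₁▷ (plug-▷ C d)
plug-▷ (S₂-l C u) d = S₂▷ (plug-▷ C d) (▷-refl u)
plug-▷ (S₂-r u C) d = S₂▷ (▷-refl u) (plug-▷ C d)
plug-▷ (F₂-l C u) d = F₂▷ (plug-▷ C d) (▷-refl u)
plug-▷ (F₂-r u C) d = F₂▷ (▷-refl u) (plug-▷ C d)
plug-▷ (app-l C u) d = app▷ (plug-▷ C d) (▷-refl u)
plug-▷ (app-r u C) d = app▷ (▷-refl u) (plug-▷ C d)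
plug-▷ (fred-1 C u v) d = fred▷ (plug-▷ C d) (▷-refl u) (▷-refl v)
plug-▷ (fred-2 u C v) d = fred▷ (▷-refl u) (plug-▷ C d) (▷-refl v)
plug-▷ (fred-3 u v C) d = fred▷ (▷-refl u) (▷-refl v) (plug-▷ C d)

perpetual-step : ∀ C {a b s} → a ⇒ b → a ▷ b → PerpSeq (plug C b) s → PerpSeq (plug C a) s
perpetual-step C st d rest = (⇒⇒⟶ (plug-⇒ C st) , ▷-∞ (plug-▷ C d)) ∷ rest

-- 5. SF-normal forms translate to inert terms

normal-left : ∀ {A B} → SFNormal (A · B) → SFNormal A
normal-left n (_ , s) = n (_ , appL _ s)

normal-right : ∀ {A B} → SFNormal (A · B) → SFNormal B
normal-right n (_ , s) = n (_ , appR _ s)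

-- Every SF-normal form is factorable: an application of a factorable form
-- of arity two would be a redex.
normal-factorable : ∀ N → SFNormal N → Factorable N
normal-factorable S n = fS
normal-factorable F n = fF
normal-factorable (A · B) n with normal-factorable A (normal-left n)
... | fS = fS1 B
... | fF = fF1 B
... | fS1 M = fS2 M B
... | fF1 M = fF2 M B
... | fS2 M N = ⊥-elim (n (_ , sRule M N B))
... | fF2 M N with normal-factorable M (normal-right (normal-left (normal-left n)))
...   | fS = ⊥-elim (n (_ , fRuleO S N B isS))
...   | fF = ⊥-elim (n (_ , fRuleO F N B isF))
...   | fS1 P = ⊥-elim (n (_ , fRuleA S P N B (fS1 P)))
...   | fF1 P = ⊥-elim (n (_ , fRuleA F P N B (fF1 P)))
...   | fS2 P Q = ⊥-elim (n (_ , fRuleA (S · P) Q N B (fS2 P Q)))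
...   | fF2 P Q = ⊥-elim (n (_ , fRuleA (F · P) Q N B (fF2 P Q)))

inert-⟦⟧ : ∀ N → SFNormal N → Inert ⟦ N ⟧ₐ
inert-⟦⟧ N n with normal-factorable N n
... | fS = S₀
... | fF = F₀
... | fS1 M = S₀· (inert-⟦⟧ M (normal-right n))
... | fF1 M = F₀· (inert-⟦⟧ M (normal-right n))
... | fS2 M P = S₀·· (inert-⟦⟧ M (normal-right (normal-left n))) (inert-⟦⟧ P (normal-right n))
... | fF2 M P = F₀·· (inert-⟦⟧ M (normal-right (normal-left n))) (inert-⟦⟧ P (normal-right n))

-- An operator applied to two normal forms is a factorable form, hence normal.
partial-normal : ∀ {O X M R} → IsOp O → SFNormal X → SFNormal M → ¬ (O · X · M ⟶SF R)
partial-normal isS nX nM (appL _ (appL _ ()))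
partial-normal isF nX nM (appL _ (appL _ ()))
partial-normal _ nX nM (appL _ (appR _ s)) = nX (_ , s)
partial-normal _ nX nM (appR _ s) = nM (_ , s)

-- 6. The perpetual simulation of the SF-rules

curry-S : ∀ C x m n → PerpSeq (plug C (app (app (app S₀ x) m) n)) (plug C (app (app x n) (app m n)))
curry-S C x m n =
  perpetual-step C (inAppˡ (inAppˡ (root (r-S0 x)))) (app▷ (app▷ (▷app (S₀-app rx)) rm) rn)
  (perpetual-step C (inAppˡ (root (r-S1 x m))) (app▷ (▷app (S₁-app rx rm)) rn)
  (perpetual-step C (root (r-S2 x m n)) (▷app (S₂-app rx rm rn rn)) (done _)))
  where rx = ▷-refl x ; rm = ▷-refl m ; rn = ▷-refl n

curry-F : ∀ C x m n {s} → PerpSeq (plug C (fred x m n)) s → PerpSeq (plug C (app (app (app F₀ x) m) n)) s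
curry-F C x m n rest =
  perpetual-step C (inAppˡ (inAppˡ (root (r-F0 x)))) (app▷ (app▷ (▷app (F₀-app rx)) rm) rn)
  (perpetual-step C (inAppˡ (root (r-F1 x m))) (app▷ (▷app (F₁-app rx rm)) rn)
  (perpetual-step C (root (r-F2 x m n)) (▷app (F₂-app rx rm rn)) rest))
  where rx = ▷-refl x ; rm = ▷-refl m ; rn = ▷-refl n

-- fred on an operator erases its third argument, which must be inert.
fred-operator : ∀ C {X} m {n} → IsOp X → Inert n → PerpSeq (plug C (fred ⟦ X ⟧ₐ m n)) (plug C m)
fred-operator C m isS w = perpetual-step C (root (f-S0 m _)) (▷fred (S₀-fred (▷-refl m) w)) (done _)
fred-operator C m isF w = perpetual-step C (root (f-F0 m _)) (▷fred (F₀-fred (▷-refl m) w)) (done _)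

-- fred on a factorable application first evaluates it to constructor form and
-- then factorises it, erasing its second argument, which must be inert.
fred-factorable : ∀ C P Q {m} n → Factorable (P · Q) → Inert m →
                  PerpSeq (plug C (fred ⟦ P · Q ⟧ₐ m n)) (plug C (app (app n ⟦ P ⟧ₐ) ⟦ Q ⟧ₐ))
fred-factorable C S A {m} n (fS1 _) w =
  perpetual-step C (inFred₁ (root (r-S0 a))) (fred▷ (▷app (S₀-app (▷-refl a))) (▷-refl m) (▷-refl n))
  (perpetual-step C (root (f-S1 a m n)) (▷fred (S₁-fred (▷-refl a) w (▷-refl n))) (done _))
  where a = ⟦ A ⟧ₐ
fred-factorable C F A {m} n (fF1 _) w =
  perpetual-step C (inFred₁ (root (r-F0 a))) (fred▷ (▷app (F₀-app (▷-refl a))) (▷-refl m) (▷-refl n))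
  (perpetual-step C (root (f-F1 a m n)) (▷fred (F₁-fred (▷-refl a) w (▷-refl n))) (done _))
  where a = ⟦ A ⟧ₐ
fred-factorable C (S · A) B {m} n (fS2 _ _) w =
  perpetual-step C (inFred₁ (inAppˡ (root (r-S0 a)))) (fred▷ (app▷ (▷app (S₀-app ra)) rb) rm rn)
  (perpetual-step C (inFred₁ (root (r-S1 a b))) (fred▷ (▷app (S₁-app ra rb)) rm rn)
  (perpetual-step C (root (f-S2 a b m n)) (▷fred (S₂-fred ra rb w rn)) (done _)))
  where a = ⟦ A ⟧ₐ ; b = ⟦ B ⟧ₐ ; ra = ▷-refl a ; rb = ▷-refl b ; rm = ▷-refl m ; rn = ▷-refl n
fred-factorable C (F · A) B {m} n (fF2 _ _) w =
  perpetual-step C (inFred₁ (inAppˡ (root (r-F0 a)))) (fred▷ (app▷ (▷app (F₀-app ra)) rb) rm rn)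
  (perpetual-step C (inFred₁ (root (r-F1 a b))) (fred▷ (▷app (F₁-app ra rb)) rm rn)
  (perpetual-step C (root (f-F2 a b m n)) (▷fred (F₂-fred ra rb w rn)) (done _)))
  where a = ⟦ A ⟧ₐ ; b = ⟦ B ⟧ₐ ; ra = ▷-refl a ; rb = ▷-refl b ; rm = ▷-refl m ; rn = ▷-refl n

-- The theorem: the step is at the root (the arguments are normal), and each
-- root rule is simulated by a perpetual reduction sequence.
mainTheorem3 : (O X M N R : SF) → IsOp O → SFNormal X → SFNormal M → SFNormal N →
                 O · X · M · N ⟶SF R → (C : Ctx) →
                 PerpSeq (plug C ⟦ O · X · M · N ⟧ₐ) (plug C ⟦ R ⟧ₐ)
mainTheorem3 _ X M N _ _ _ _ _ (sRule _ _ _) C = curry-S C ⟦ X ⟧ₐ ⟦ M ⟧ₐ ⟦ N ⟧ₐ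
mainTheorem3 _ X M N _ _ _ _ nN (fRuleO _ _ _ opX) C =
  curry-F C _ _ _ (fred-operator C ⟦ M ⟧ₐ opX (inert-⟦⟧ N nN))
mainTheorem3 _ _ M N _ _ _ nM _ (fRuleA P Q _ _ fPQ) C =
  curry-F C _ _ _ (fred-factorable C P Q ⟦ N ⟧ₐ fPQ (inert-⟦⟧ M nM))
mainTheorem3 _ _ _ _ _ op nX nM _ (appL _ s) _ = ⊥-elim (partial-normal op nX nM s)
mainTheorem3 _ _ _ _ _ _ _ _ nN (appR _ s) _ = ⊥-elim (nN (_ , s))
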